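{- Let $S$ be a set-valued tableau having at least one multicell and let $S'=di(S)$ be its dilation. Then $RSK(w(S))=RSK(w(S'))$.
   Context: Partitions are drawn as Ferrers diagrams in French convention (row 1 is the bottom row). A set-valued tableau fills each cell with a nonempty finite set of positive integers such that the maximum of each cell is $\le$ the minimum of the cell to its right and $<$ the minimum of the cell above it; a multicell is a cell with more than one element. Reading word $w(S)$: process rows from top to bottom; in each row, first list, ignoring the smallest element of each cell, the remaining elements of the cells from the rightmost cell to the leftmost, within each cell from largest to smallest; then list the smallest elements of the cells from left to right. (For a tableau with singleton cells this is reading the rows top to bottom, each left to right.) $RSK(w)$ denotes the insertion tableau of Schensted row insertion of the letters of $w$ from left to right into the empty tableau (inserting $y$ into a row: if no entry exceeds $y$, append it; otherwise $y$ replaces the leftmost entry strictly greater than $y$, which is inserted into the next row up). Dilation: $row(S)$ is the highest row containing a multicell; $S_{>row(S)}$ is the subtableau of rows strictly above it. $di(S)$ is obtained by removing the largest entry $x$ from the rightmost multicell of row $row(S)$ and row-inserting $x$ into $S_{>row(S)}$ starting at row $row(S)+1$. -}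

module Defs where

open import Data.Nat using (ℕ; zero; suc; _≤_; _<_; _<ᵇ_)
open import Data.Bool using (Bool; true; false; if_then_else_)
open import Data.List using (List; []; _∷_; _++_; reverse; map; concatMap; drop; foldl; length)
open import Data.List.Relation.Unary.All using (All)
open import Data.List.Relation.Unary.Any using (Any)
open import Data.List.Relation.Binary.Pointwise using (Pointwise)
open import Data.List.Relation.Unary.Linked using (Linked)
open import Data.Maybe using (Maybe; just; nothing)
open import Data.Product using (_×_; _,_)
open import Data.Unit using (⊤)
open import Data.Empty using (⊥)

-- A cell (a nonempty finite set of positive integers) is represented
-- canonically by the strictly increasing list of its elements.
-- A row is the list of its cells from left to right.
-- A (set-valued) tableau is the list of its rows, bottom row first
-- (French convention: row 1 = head of the list).

Cell : Set
Cell = List ℕ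

Row : Set
Row = List Cell

Tableau : Set
Tableau = List Row

-- smallest / largest element of a cell (cells are strictly increasing
-- lists, so these are head / last; the default 0 is never used for
-- valid cells).
minC : Cell → ℕ
minC []      = 0
minC (x ∷ _) = x

maxC : Cell → ℕ
maxC []           = 0
maxC (x ∷ [])     = x
maxC (_ ∷ y ∷ xs) = maxC (y ∷ xs)

removeMax : Cell → Cell
removeMax []           = []
removeMax (x ∷ [])     = []
removeMax (x ∷ y ∷ xs) = x ∷ removeMax (y ∷ xs)

IsMulticell : Cell → Set
IsMulticell c = 2 ≤ length c

isMulti : Cell → Bool
isMulti (_ ∷ _ ∷ _) = true
isMulti _           = false

ValidCell : Cell → Set
ValidCell c = (1 ≤ length c) × All (λ x → 1 ≤ x) c × Linked _<_ c

RowRel : Cell → Cell → Set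
RowRel c d = maxC c ≤ minC d

-- vertical condition between a row r and the row r' directly above it:
-- r' is not longer than r, and each cell of r' has minimum strictly
-- larger than the maximum of the cell below it.
ColOK : Row → Row → Set
ColOK _       []        = ⊤
ColOK []      (_ ∷ _)   = ⊥
ColOK (c ∷ r) (c' ∷ r') = (maxC c < minC c') × ColOK r r'

-- S is a set-valued tableau of partition shape (rows nonempty,
-- row lengths weakly decreasing upward, which is enforced by ColOK).
IsSetValuedTableau : Tableau → Set
IsSetValuedTableau S =
  All (λ r → 1 ≤ length r) S ×
  All (All ValidCell) S ×
  All (Linked RowRel) S ×
  Linked ColOK S

HasMulticell : Tableau → Set
HasMulticell S = Any (Any IsMulticell) S

rowWord : Row → List ℕ
rowWord r = concatMap (λ c → reverse (drop 1 c)) (reverse r) ++ map minC r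

readingWord : Tableau → List ℕ
readingWord S = concatMap rowWord (reverse S)

-- Schensted row insertion (ordinary tableaux: list of rows of ℕ,
-- bottom row first)

insertRow : ℕ → List ℕ → Maybe ℕ × List ℕ
insertRow y []      = nothing , y ∷ []
insertRow y (a ∷ r) with y <ᵇ a
... | true  = just a , y ∷ r
... | false with insertRow y r
...   | m , r' = m , a ∷ r'

insertT : ℕ → List (List ℕ) → List (List ℕ)
insertT y []       = (y ∷ []) ∷ []
insertT y (r ∷ rs) with insertRow y r
... | nothing , r' = r' ∷ rs
... | just z  , r' = r' ∷ insertT z rs

RSK : List ℕ → List (List ℕ)
RSK w = foldl (λ T y → insertT y T) [] w

rowHasMulti : Row → Bool
rowHasMulti []      = false
rowHasMulti (c ∷ r) = if isMulti c then true else rowHasMulti r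

-- given the rows listed top to bottom, split off the rows above the
-- highest row containing a multicell:
-- returns (rows above, top-first) and, if it exists, the row row(S)
-- together with the rows below it (top-first).
splitTop : List Row → List Row × Maybe (Row × List Row)
splitTop []       = [] , nothing
splitTop (r ∷ rs) with rowHasMulti r
... | true  = [] , just (r , rs)
... | false with splitTop rs
...   | above , rest = r ∷ above , rest

-- on a row listed right-to-left: remove the largest entry of the first
-- (i.e. rightmost) multicell
removeFromFirstMulti : List Cell → Maybe (ℕ × List Cell)
removeFromFirstMulti []       = nothing
removeFromFirstMulti (c ∷ cs) with isMulti c
... | true  = just (maxC c , removeMax c ∷ cs)
... | false with removeFromFirstMulti cs
...   | nothing        = nothing
...   | just (x , cs') = just (x , c ∷ cs')

-- rows above row(S) consist of singleton cells; view them as an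
-- ordinary tableau and back
toPlain : Row → List ℕ
toPlain = map minC

fromPlain : List ℕ → Row
fromPlain = map (λ x → x ∷ [])

-- di(S): remove the largest entry x of the rightmost multicell of row
-- row(S) and row-insert x into S_{>row(S)} starting at row row(S)+1.
-- (Returns S unchanged when S has no multicell; not used then.)
di : Tableau → Tableau
di S with splitTop (reverse S)
... | _ , nothing = S
... | above , just (r , below) with removeFromFirstMulti (reverse r)
...   | nothing = S
...   | just (x , rrev) =
          reverse below ++ (reverse rrev ∷
            map fromPlain (insertT x (map toPlain (reverse above))))

-- The rows of S above row(S) consist of singleton cells, so they form an ordinary
-- semistandard tableau T, and w(S) reads T row by row, then the entry x that the
-- dilation moves (the largest entry of the rightmost multicell of row(S) comes first
-- in that row's word), then a word w'. Dilation replaces T by T ← x and leaves w'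
-- in place, so w(di S) reads T ← x, then w'. By Schensted, every semistandard
-- tableau is the insertion tableau of its own reading word (inserting its bottom row
-- into the rows above pushes every column up by one cell), hence both RSK(w(S)) and
-- RSK(w(di S)) equal (T ← x) ← w'.

module Submission where

open import Defs
open import Data.Bool using (true; false; T)
open import Data.Bool.Properties using (T-≡)
open import Data.Empty using (⊥)
open import Data.List
  using (List; []; _∷_; _++_; [_]; take; drop; length; reverse; map; concat; concatMap; foldl)
open import Data.List.Properties
  using (take-all; drop-all; length-drop; ++-assoc; ++-identityʳ; foldl-++; unfold-reverse; concat-++;
         reverse-++; reverse-involutive; reverse-map; concatMap-++; map-∘; map-id; map-cong)
open import Data.List.Relation.Unary.All as All using (All; []; _∷_)
import Data.List.Relation.Unary.All.Properties as AllP
open import Data.List.Relation.Unary.AllPairs using (AllPairs; []; _∷_)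
open import Data.List.Relation.Unary.Any as Any using (Any; here; there)
import Data.List.Relation.Unary.Any.Properties as AnyP
open import Data.List.Relation.Unary.Linked as Linked using (Linked; []; [-]; _∷_)
open import Data.List.Relation.Unary.Linked.Properties using (Linked⇒AllPairs)
open import Data.Maybe using (nothing; just)
open import Data.Nat using (ℕ; zero; suc; _≤_; _<_; _<ᵇ_; z≤n; s≤s)
open import Data.Nat.Properties
  using (<ᵇ⇒<; <⇒<ᵇ; ≤⇒≯; ≮⇒≥; <⇒≤; ≤-trans; ≤-<-trans; m≤n⇒m≤1+n; m∸n≡0⇒m≤n; _<?_)
open import Data.Product using (∃-syntax; _×_; _,_; proj₂; map₂)
open import Data.Unit using (⊤; tt)
open import Function using (_∘_; id)
open import Function.Bundles using (Equivalence)
open import Relation.Binary.PropositionalEquality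
  using (_≡_; refl; sym; trans; cong; cong₂; subst; module ≡-Reasoning)
open import Relation.Nullary using (yes; no; contradiction)

private
  variable
    a b y z : ℕ
    p q u v : List ℕ
    rs : List (List ℕ)

All-reverse : ∀ {A : Set} {P : A → Set} {xs} → All P xs → All P (reverse xs)
All-reverse {xs = []}     []         = []
All-reverse {xs = x ∷ xs} (px ∷ pxs) rewrite unfold-reverse x xs = AllP.∷ʳ⁺ (All-reverse pxs) px

All-replace : ∀ {A : Set} {P : A → Set} u {z y : A} {v} → All P (u ++ z ∷ v) → P y → All P (u ++ y ∷ v)
All-replace []      (_ ∷ pv)  py = py ∷ pv
All-replace (_ ∷ u) (pa ∷ pr) py = pa ∷ All-replace u pr py

Linked-++⁻ʳ : ∀ {A : Set} {R : A → A → Set} xs {ys} → Linked R (xs ++ ys) → Linked R ys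
Linked-++⁻ʳ []       l = l
Linked-++⁻ʳ (_ ∷ xs) l = Linked-++⁻ʳ xs (Linked.tail l)

Linked-replaceHead : ∀ {A : Set} {R : A → A → Set} {x x' xs} →
  (∀ {w} → R x w → R x' w) → Linked R (x ∷ xs) → Linked R (x' ∷ xs)
Linked-replaceHead f [-]      = [-]
Linked-replaceHead f (r ∷ rs) = f r ∷ rs

reverse-++-∷ : ∀ {A : Set} xs (y : A) ys → reverse (xs ++ y ∷ ys) ≡ reverse ys ++ y ∷ reverse xs
reverse-++-∷ xs y ys = begin
  reverse (xs ++ y ∷ ys)                 ≡⟨ reverse-++ xs (y ∷ ys) ⟩
  reverse (y ∷ ys) ++ reverse xs         ≡⟨ cong (_++ reverse xs) (unfold-reverse y ys) ⟩
  (reverse ys ++ [ y ]) ++ reverse xs    ≡⟨ ++-assoc (reverse ys) [ y ] (reverse xs) ⟩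
  reverse ys ++ y ∷ reverse xs           ∎
  where open ≡-Reasoning

take-suc-drop : ∀ {A : Set} j (p : List A) {y t} → drop j p ≡ y ∷ t → take (suc j) p ≡ take j p ++ [ y ]
take-suc-drop zero    (a ∷ p) refl = refl
take-suc-drop (suc j) (a ∷ p) e    = cong (a ∷_) (take-suc-drop j p e)

drop-suc-drop : ∀ {A : Set} j (p : List A) {y t} → drop j p ≡ y ∷ t → drop (suc j) p ≡ t
drop-suc-drop zero    (a ∷ p) refl = refl
drop-suc-drop (suc j) (a ∷ p) e    = drop-suc-drop j p e

length≤-drop≡[] : ∀ {A : Set} j (p : List A) → drop j p ≡ [] → length p ≤ j
length≤-drop≡[] j p e = m∸n≡0⇒m≤n (trans (sym (length-drop j p)) (cong length e))

-- Schensted row insertion on semistandard tableaux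

<ᵇ≡false : a ≤ y → (y <ᵇ a) ≡ false
<ᵇ≡false {a} {y} a≤y with y <ᵇ a in eq
... | false = refl
... | true  = contradiction (<ᵇ⇒< y a (subst T (sym eq) tt)) (≤⇒≯ a≤y)

<ᵇ≡true : y < a → (y <ᵇ a) ≡ true
<ᵇ≡true y<a = Equivalence.to T-≡ (<⇒<ᵇ y<a)

insertRow-append : All (_≤ y) p → insertRow y p ≡ (nothing , p ++ [ y ])
insertRow-append {p = []}    []          = refl
insertRow-append {p = a ∷ p} (a≤y ∷ p≤y) rewrite <ᵇ≡false a≤y | insertRow-append p≤y = refl

insertRow-bump : All (_≤ y) u → y < z → insertRow y (u ++ z ∷ v) ≡ (just z , u ++ y ∷ v)
insertRow-bump {u = []}    []          y<z rewrite <ᵇ≡true y<z = refl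
insertRow-bump {u = a ∷ u} {v = v} (a≤y ∷ u≤y) y<z
  rewrite <ᵇ≡false a≤y | insertRow-bump {v = v} u≤y y<z = refl

insertRow-skip : b ≤ z → insertRow z (b ∷ q) ≡ map₂ (b ∷_) (insertRow z q)
insertRow-skip {z = z} {q = q} b≤z rewrite <ᵇ≡false b≤z with insertRow z q
... | _ , _ = refl

Sorted : List ℕ → Set
Sorted = AllPairs _≤_

-- ColumnStrict p q: the row q lies directly on top of the row p.
ColumnStrict : List ℕ → List ℕ → Set
ColumnStrict _       []      = ⊤
ColumnStrict []      (_ ∷ _) = ⊥
ColumnStrict (a ∷ p) (b ∷ q) = a < b × ColumnStrict p q

data NonEmpty : List ℕ → Set where
  nonEmpty : NonEmpty (a ∷ p)

record IsSemistandard (t : List (List ℕ)) : Set where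
  constructor semistandard
  field
    rows-sorted    : All Sorted t
    rows-nonEmpty  : All NonEmpty t
    columns-strict : Linked ColumnStrict t

isSemistandard-tail : ∀ {r} → IsSemistandard (r ∷ rs) → IsSemistandard rs
isSemistandard-tail (semistandard (_ ∷ ss) (_ ∷ ns) cs) = semistandard ss ns (Linked.tail cs)

data InsertionPoint (y : ℕ) : List ℕ → Set where
  append : All (_≤ y) p → InsertionPoint y p
  bump   : ∀ v → All (_≤ y) u → y < z → InsertionPoint y (u ++ z ∷ v)

insertionPoint : ∀ y p → InsertionPoint y p
insertionPoint y []      = append []
insertionPoint y (a ∷ p) with y <? a | insertionPoint y p
... | yes y<a | _               = bump p [] y<a
... | no  y≮a | append p≤y      = append (≮⇒≥ y≮a ∷ p≤y)
... | no  y≮a | bump v u≤y y<z  = bump v (≮⇒≥ y≮a ∷ u≤y) y<z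

insertT-append : All (_≤ y) p → insertT y (p ∷ rs) ≡ (p ++ [ y ]) ∷ rs
insertT-append p≤y rewrite insertRow-append p≤y = refl

insertT-bump : All (_≤ y) u → y < z → insertT y ((u ++ z ∷ v) ∷ rs) ≡ (u ++ y ∷ v) ∷ insertT z rs
insertT-bump {v = v} u≤y y<z rewrite insertRow-bump {v = v} u≤y y<z = refl

sorted-append : Sorted p → All (_≤ y) p → Sorted (p ++ [ y ])
sorted-append {p = []}    _         _           = [] ∷ []
sorted-append {p = a ∷ p} (a≤p ∷ sp) (a≤y ∷ p≤y) =
  AllP.++⁺ a≤p (a≤y ∷ []) ∷ sorted-append sp p≤y

sorted-replace : Sorted (u ++ z ∷ v) → All (_≤ y) u → y ≤ z → Sorted (u ++ y ∷ v)
sorted-replace {u = []}    (z≤v ∷ sv) _           y≤z = All.map (≤-trans y≤z) z≤v ∷ sv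
sorted-replace {u = a ∷ u} (a≤r ∷ sr) (a≤y ∷ u≤y) y≤z =
  All-replace u a≤r a≤y ∷ sorted-replace sr u≤y y≤z

nonEmpty-++-∷ : ∀ u → NonEmpty (u ++ y ∷ v)
nonEmpty-++-∷ []      = nonEmpty
nonEmpty-++-∷ (_ ∷ _) = nonEmpty

columnStrict-++ : ∀ {w} → ColumnStrict p q → ColumnStrict (p ++ w) q
columnStrict-++ {q = []}    _ = tt
columnStrict-++ {p = a ∷ p} {q = b ∷ q} (a<b , c) = a<b , columnStrict-++ {p = p} c

columnStrict-lower : ColumnStrict (u ++ z ∷ v) q → y ≤ z → ColumnStrict (u ++ y ∷ v) q
columnStrict-lower {q = []}    _ _ = tt
columnStrict-lower {u = []}    {q = b ∷ q} (z<b , c) y≤z = ≤-<-trans y≤z z<b , c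
columnStrict-lower {u = a ∷ u} {q = b ∷ q} (a<b , c) y≤z = a<b , columnStrict-lower {u = u} c y≤z

-- z enters q weakly to the left of the column it vacated, hence above an entry ≤ y < z.
columnStrict-bump : All (_≤ y) u → y < z → ColumnStrict (u ++ z ∷ v) q →
  ColumnStrict (u ++ y ∷ v) (proj₂ (insertRow z q))
columnStrict-bump {u = []}    {q = []}    _ y<z _ = y<z , tt
columnStrict-bump {u = []}    {q = b ∷ q} _ y<z (z<b , c) rewrite <ᵇ≡true z<b = y<z , c
columnStrict-bump {u = a ∷ u} {q = []}    (a≤y ∷ _) y<z _ = ≤-<-trans a≤y y<z , tt
columnStrict-bump {u = a ∷ u} {z = z} {q = b ∷ q} (a≤y ∷ u≤y) y<z (a<b , c) with z <? b
... | yes z<b rewrite <ᵇ≡true z<b = ≤-<-trans a≤y y<z , columnStrict-lower {u = u} c (<⇒≤ y<z)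
... | no  z≮b rewrite insertRow-skip {q = q} (≮⇒≥ z≮b) = a<b , columnStrict-bump u≤y y<z c

Linked-bump : All (_≤ y) u → y < z → ∀ rs →
  Linked ColumnStrict ((u ++ z ∷ v) ∷ rs) → Linked ColumnStrict (insertT z rs) →
  Linked ColumnStrict ((u ++ y ∷ v) ∷ insertT z rs)
Linked-bump u≤y y<z [] _ _ = columnStrict-bump {q = []} u≤y y<z tt ∷ [-]
Linked-bump {z = z} u≤y y<z (q ∷ rs) (c ∷ _) l
  with insertRow z q | columnStrict-bump u≤y y<z c
... | nothing , q' | c' = c' ∷ l
... | just _  , q' | c' = c' ∷ l

insertT-isSemistandard : ∀ y t → IsSemistandard t → IsSemistandard (insertT y t)
insertT-isSemistandard y [] _ = semistandard (([] ∷ []) ∷ []) (nonEmpty ∷ []) [-]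
insertT-isSemistandard y (p ∷ rs) st@(semistandard (sp ∷ ss) (_ ∷ ns) cs) with insertionPoint y p
... | append p≤y rewrite insertT-append {rs = rs} p≤y =
  semistandard (sorted-append sp p≤y ∷ ss) (nonEmpty-++-∷ p ∷ ns)
               (Linked-replaceHead (columnStrict-++ {p = p}) cs)
... | bump {u = u} {z = z} v u≤y y<z rewrite insertT-bump {v = v} {rs = rs} u≤y y<z =
  semistandard (sorted-replace sp u≤y (<⇒≤ y<z) ∷ rows-sorted st')
               (nonEmpty-++-∷ u ∷ rows-nonEmpty st')
               (Linked-bump u≤y y<z rs cs (columns-strict st'))
  where
    open IsSemistandard
    st' : IsSemistandard (insertT z rs)
    st' = insertT-isSemistandard z rs (isSemistandard-tail st)

-- A semistandard tableau is the insertion tableau of its reading word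

insertAll : List (List ℕ) → List ℕ → List (List ℕ)
insertAll = foldl (λ t y → insertT y t)

plainReadingWord : List (List ℕ) → List ℕ
plainReadingWord t = concat (reverse t)

plainReadingWord-∷ : ∀ r rs → plainReadingWord (r ∷ rs) ≡ plainReadingWord rs ++ r
plainReadingWord-∷ r rs = begin
  concat (reverse (r ∷ rs))           ≡⟨ cong concat (unfold-reverse r rs) ⟩
  concat (reverse rs ++ [ r ])        ≡⟨ concat-++ (reverse rs) [ r ] ⟨
  concat (reverse rs) ++ (r ++ [])    ≡⟨ cong (concat (reverse rs) ++_) (++-identityʳ r) ⟩
  concat (reverse rs) ++ r            ∎
  where open ≡-Reasoning

rowTableau : List ℕ → List (List ℕ)
rowTableau []       = []
rowTableau (a ∷ p)  = (a ∷ p) ∷ []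

-- The state reached after inserting the first j entries of the row p into the
-- tableau rs lying on top of it: the first j entries of every row have moved up one row.
pushUp : ℕ → List ℕ → List (List ℕ) → List (List ℕ)
pushUp j p []       = rowTableau (take j p)
pushUp j p (r ∷ rs) = (take j p ++ drop j r) ∷ pushUp j r rs

sorted-take : ∀ j {t} p → Sorted p → drop j p ≡ y ∷ t → All (_≤ y) (take j p)
sorted-take zero    p       _           _ = []
sorted-take (suc j) (a ∷ p) (a≤p ∷ sp) e = head≤ j p a≤p e ∷ sorted-take j p sp e
  where
    head≤ : ∀ j {t} p → All (a ≤_) p → drop j p ≡ y ∷ t → a ≤ y
    head≤ zero    (b ∷ p) (a≤b ∷ _)  refl = a≤b
    head≤ (suc j) (b ∷ p) (_ ∷ a≤p)  e    = head≤ j p a≤p e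

columnStrict-drop : ∀ j {t s} p r → ColumnStrict p r → drop j p ≡ y ∷ t → drop j r ≡ z ∷ s → y < z
columnStrict-drop zero    (a ∷ p) (b ∷ r) (a<b , _) refl refl = a<b
columnStrict-drop (suc j) (a ∷ p) (b ∷ r) (_ , c)   e₁   e₂   = columnStrict-drop j p r c e₁ e₂

columnStrict-length : ∀ p q → ColumnStrict p q → length q ≤ length p
columnStrict-length p       []      _       = z≤n
columnStrict-length (a ∷ p) (b ∷ q) (_ , c) = s≤s (columnStrict-length p q c)

pushUp-zero : ∀ p rs → pushUp 0 p rs ≡ rs
pushUp-zero p []       = refl
pushUp-zero p (r ∷ rs) = cong (r ∷_) (pushUp-zero r rs)

pushUp-complete : ∀ j p rs → length p ≤ j → IsSemistandard (p ∷ rs) → pushUp j p rs ≡ p ∷ rs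
pushUp-complete j p [] p≤j (semistandard _ (nonEmpty ∷ _) _) rewrite take-all j p p≤j = refl
pushUp-complete j p (r ∷ rs) p≤j st@(semistandard _ _ (c ∷ _)) = cong₂ _∷_
  (trans (cong₂ _++_ (take-all j p p≤j) (drop-all j r r≤j)) (++-identityʳ p))
  (pushUp-complete j r rs r≤j (isSemistandard-tail st))
  where
    r≤j : length r ≤ j
    r≤j = ≤-trans (columnStrict-length p r c) p≤j

insertT-rowTableau : All (_≤ y) u → insertT y (rowTableau u) ≡ rowTableau (u ++ [ y ])
insertT-rowTableau {u = []}    _   = refl
insertT-rowTableau {u = _ ∷ _} u≤y = insertT-append u≤y

insertT-pushUp : ∀ j {t} p rs → IsSemistandard (p ∷ rs) → drop j p ≡ y ∷ t →
  insertT y (pushUp j p rs) ≡ pushUp (suc j) p rs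
insertT-pushUp {y} j p [] (semistandard (sp ∷ _) _ _) e = begin
  insertT y (rowTableau (take j p))  ≡⟨ insertT-rowTableau (sorted-take j p sp e) ⟩
  rowTableau (take j p ++ [ y ])     ≡⟨ cong rowTableau (take-suc-drop j p e) ⟨
  rowTableau (take (suc j) p)        ∎
  where open ≡-Reasoning
insertT-pushUp {y} j p (r ∷ rs) st@(semistandard (sp ∷ _) _ (c ∷ _)) e with drop j r in e'
... | [] = begin
  insertT y ((take j p ++ []) ∷ pushUp j r rs)
    ≡⟨ cong (λ w → insertT y (w ∷ pushUp j r rs)) (++-identityʳ (take j p)) ⟩
  insertT y (take j p ∷ pushUp j r rs)
    ≡⟨ insertT-append {p = take j p} (sorted-take j p sp e) ⟩
  (take j p ++ [ y ]) ∷ pushUp j r rs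
    ≡⟨ cong₂ _∷_ top rest ⟩
  (take (suc j) p ++ drop (suc j) r) ∷ pushUp (suc j) r rs
    ∎
  where
    open ≡-Reasoning
    r≤j : length r ≤ j
    r≤j = length≤-drop≡[] j r e'
    st' : IsSemistandard (r ∷ rs)
    st' = isSemistandard-tail st
    top : take j p ++ [ y ] ≡ take (suc j) p ++ drop (suc j) r
    top rewrite take-suc-drop j p e | drop-all (suc j) r (m≤n⇒m≤1+n r≤j) = sym (++-identityʳ _)
    rest : pushUp j r rs ≡ pushUp (suc j) r rs
    rest = trans (pushUp-complete j r rs r≤j st')
                 (sym (pushUp-complete (suc j) r rs (m≤n⇒m≤1+n r≤j) st'))
... | z ∷ s = begin
  insertT y ((take j p ++ z ∷ s) ∷ pushUp j r rs)
    ≡⟨ insertT-bump (sorted-take j p sp e) (columnStrict-drop j p r c e e') ⟩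
  (take j p ++ y ∷ s) ∷ insertT z (pushUp j r rs)
    ≡⟨ cong₂ _∷_ top (insertT-pushUp j r rs (isSemistandard-tail st) e') ⟩
  (take (suc j) p ++ drop (suc j) r) ∷ pushUp (suc j) r rs
    ∎
  where
    open ≡-Reasoning
    top : take j p ++ y ∷ s ≡ take (suc j) p ++ drop (suc j) r
    top rewrite take-suc-drop j p e | drop-suc-drop j r e' = sym (++-assoc (take j p) [ y ] s)

insertAll-pushUp : ∀ j p rs t → IsSemistandard (p ∷ rs) → drop j p ≡ t →
  insertAll (pushUp j p rs) t ≡ p ∷ rs
insertAll-pushUp j p rs []      st e = pushUp-complete j p rs (length≤-drop≡[] j p e) st
insertAll-pushUp j p rs (y ∷ t) st e rewrite insertT-pushUp j p rs st e =
  insertAll-pushUp (suc j) p rs t st (drop-suc-drop j p e)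

insertAll-row : ∀ p rs → IsSemistandard (p ∷ rs) → insertAll rs p ≡ p ∷ rs
insertAll-row p rs st = begin
  insertAll rs p             ≡⟨ cong (λ t → insertAll t p) (pushUp-zero p rs) ⟨
  insertAll (pushUp 0 p rs) p ≡⟨ insertAll-pushUp 0 p rs p st refl ⟩
  p ∷ rs                     ∎
  where open ≡-Reasoning

RSK-plainReadingWord-++ : ∀ t w → IsSemistandard t → RSK (plainReadingWord t ++ w) ≡ insertAll t w
RSK-plainReadingWord-++ []       w _  = refl
RSK-plainReadingWord-++ (r ∷ rs) w st = begin
  RSK (plainReadingWord (r ∷ rs) ++ w)    ≡⟨ cong (λ v → RSK (v ++ w)) (plainReadingWord-∷ r rs) ⟩
  RSK ((plainReadingWord rs ++ r) ++ w)   ≡⟨ cong RSK (++-assoc (plainReadingWord rs) r w) ⟩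
  RSK (plainReadingWord rs ++ r ++ w)     ≡⟨ RSK-plainReadingWord-++ rs (r ++ w) (isSemistandard-tail st) ⟩
  insertAll rs (r ++ w)                   ≡⟨ foldl-++ _ rs r w ⟩
  insertAll (insertAll rs r) w            ≡⟨ cong (λ t → insertAll t w) (insertAll-row r rs st) ⟩
  insertAll (r ∷ rs) w                    ∎
  where open ≡-Reasoning

-- Reading words of set-valued tableaux and of their dilations

NoMulticell : Row → Set
NoMulticell = All (λ c → isMulti c ≡ false)

rowHasMulti-Any : ∀ {r} → Any IsMulticell r → rowHasMulti r ≡ true
rowHasMulti-Any {(_ ∷ _ ∷ _) ∷ _} (here _) = refl
rowHasMulti-Any {(_ ∷ []) ∷ _} (here (s≤s ()))
rowHasMulti-Any {c ∷ _} (there m) with isMulti c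
... | true  = refl
... | false = rowHasMulti-Any m

rowHasMulti-true : ∀ r → rowHasMulti r ≡ true → Any (λ c → isMulti c ≡ true) r
rowHasMulti-true (c ∷ r) e with isMulti c in ec
... | true  = here ec
... | false = there (rowHasMulti-true r e)

rowHasMulti-false : ∀ r → rowHasMulti r ≡ false → NoMulticell r
rowHasMulti-false []      _ = []
rowHasMulti-false (c ∷ r) e with isMulti c in ec
... | false = ec ∷ rowHasMulti-false r e

splitTop-just : ∀ L → Any (λ r → rowHasMulti r ≡ true) L →
  ∃[ above ] ∃[ r ] ∃[ below ]
    splitTop L ≡ (above , just (r , below)) × L ≡ above ++ r ∷ below ×
    All NoMulticell above × rowHasMulti r ≡ true
splitTop-just (r ∷ L) m with rowHasMulti r in e | m
... | true  | _       = [] , r , L , refl , refl , [] , e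
... | false | here px = contradiction (trans (sym e) px) λ ()
... | false | there m' with splitTop-just L m'
...   | above , r' , below , eq , refl , none , multi rewrite eq =
          r ∷ above , r' , below , refl , refl , rowHasMulti-false r e ∷ none , multi

extraEntries : Cell → List ℕ
extraEntries c = reverse (drop 1 c)

extraEntries-single : ∀ c → isMulti c ≡ false → extraEntries c ≡ []
extraEntries-single []          _ = refl
extraEntries-single (_ ∷ [])    _ = refl

removeMax-++-maxC : ∀ a l → a ∷ l ≡ removeMax (a ∷ l) ++ [ maxC (a ∷ l) ]
removeMax-++-maxC a []      = refl
removeMax-++-maxC a (b ∷ l) = cong (a ∷_) (removeMax-++-maxC b l)

extraEntries-multi : ∀ c → isMulti c ≡ true → extraEntries c ≡ maxC c ∷ extraEntries (removeMax c)
extraEntries-multi (a ∷ b ∷ l) _ = begin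
  reverse (b ∷ l)                                  ≡⟨ cong reverse (removeMax-++-maxC b l) ⟩
  reverse (removeMax (b ∷ l) ++ [ maxC (b ∷ l) ])  ≡⟨ reverse-++ (removeMax (b ∷ l)) _ ⟩
  maxC (b ∷ l) ∷ reverse (removeMax (b ∷ l))       ∎
  where open ≡-Reasoning

removeFromFirstMulti-just : ∀ cs → Any (λ c → isMulti c ≡ true) cs →
  ∃[ x ] ∃[ cs' ] removeFromFirstMulti cs ≡ just (x , cs') ×
    concatMap extraEntries cs ≡ x ∷ concatMap extraEntries cs' × map minC cs ≡ map minC cs'
removeFromFirstMulti-just (c ∷ cs) m with isMulti c in e | m
... | true | _ =
  maxC c , removeMax c ∷ cs , refl , cong (_++ concatMap extraEntries cs) (extraEntries-multi c e) ,
  cong (_∷ map minC cs) (minC-removeMax c e)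
  where
    minC-removeMax : ∀ c → isMulti c ≡ true → minC c ≡ minC (removeMax c)
    minC-removeMax (_ ∷ _ ∷ _) _ = refl
... | false | here px = contradiction (trans (sym e) px) λ ()
... | false | there m' with removeFromFirstMulti-just cs m'
...   | x , cs' , eq , extra , mins rewrite eq =
          x , c ∷ cs' , refl ,
          subst (λ w → w ++ _ ≡ x ∷ w ++ _) (sym (extraEntries-single c e)) extra ,
          cong (minC c ∷_) mins

readingWord-++ : ∀ B A → readingWord (B ++ A) ≡ readingWord A ++ readingWord B
readingWord-++ B A =
  trans (cong (concatMap rowWord) (reverse-++ B A)) (concatMap-++ rowWord (reverse A) (reverse B))

readingWord-∷ : ∀ r A → readingWord (r ∷ A) ≡ readingWord A ++ rowWord r
readingWord-∷ r A = trans (readingWord-++ [ r ] A) (cong (readingWord A ++_) (++-identityʳ (rowWord r)))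

readingWord-++-∷ : ∀ B r A → readingWord (B ++ r ∷ A) ≡ readingWord A ++ rowWord r ++ readingWord B
readingWord-++-∷ B r A = begin
  readingWord (B ++ r ∷ A)                     ≡⟨ readingWord-++ B (r ∷ A) ⟩
  readingWord (r ∷ A) ++ readingWord B         ≡⟨ cong (_++ readingWord B) (readingWord-∷ r A) ⟩
  (readingWord A ++ rowWord r) ++ readingWord B ≡⟨ ++-assoc (readingWord A) (rowWord r) (readingWord B) ⟩
  readingWord A ++ rowWord r ++ readingWord B  ∎
  where open ≡-Reasoning

concatMap-extraEntries-noMulticell : ∀ {cs} → NoMulticell cs → concatMap extraEntries cs ≡ []
concatMap-extraEntries-noMulticell {[]}     []       = refl
concatMap-extraEntries-noMulticell {c ∷ cs} (e ∷ es) =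
  cong₂ _++_ (extraEntries-single c e) (concatMap-extraEntries-noMulticell es)

rowWord-noMulticell : ∀ {r} → NoMulticell r → rowWord r ≡ toPlain r
rowWord-noMulticell {r} nm =
  cong (_++ map minC r) (concatMap-extraEntries-noMulticell (All-reverse nm))

readingWord-noMulticell : ∀ A → All NoMulticell A → readingWord A ≡ plainReadingWord (map toPlain A)
readingWord-noMulticell []      []         = refl
readingWord-noMulticell (r ∷ A) (nm ∷ nms) = begin
  readingWord (r ∷ A)
    ≡⟨ readingWord-∷ r A ⟩
  readingWord A ++ rowWord r
    ≡⟨ cong₂ _++_ (readingWord-noMulticell A nms) (rowWord-noMulticell nm) ⟩
  plainReadingWord (map toPlain A) ++ toPlain r
    ≡⟨ plainReadingWord-∷ (toPlain r) (map toPlain A) ⟨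
  plainReadingWord (map toPlain (r ∷ A))
    ∎
  where open ≡-Reasoning

toPlain-fromPlain : ∀ p → toPlain (fromPlain p) ≡ p
toPlain-fromPlain p = trans (sym (map-∘ p)) (map-id p)

readingWord-fromPlain : ∀ t → readingWord (map fromPlain t) ≡ plainReadingWord t
readingWord-fromPlain t = begin
  readingWord (map fromPlain t)                     ≡⟨ readingWord-noMulticell _ singletons ⟩
  plainReadingWord (map toPlain (map fromPlain t))  ≡⟨ cong plainReadingWord (map-∘ t) ⟨
  plainReadingWord (map (toPlain ∘ fromPlain) t)    ≡⟨ cong plainReadingWord (map-cong toPlain-fromPlain t) ⟩
  plainReadingWord (map id t)                       ≡⟨ cong plainReadingWord (map-id t) ⟩
  plainReadingWord t                                ∎
  where
    open ≡-Reasoning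
    singletons : All NoMulticell (map fromPlain t)
    singletons = AllP.map⁺ (All.universal (λ p → AllP.map⁺ (All.universal (λ _ → refl) p)) t)

rowWord-dilated : ∀ r x cs' →
  concatMap extraEntries (reverse r) ≡ x ∷ concatMap extraEntries cs' →
  map minC (reverse r) ≡ map minC cs' →
  rowWord r ≡ x ∷ rowWord (reverse cs')
rowWord-dilated r x cs' extra mins = begin
  concatMap extraEntries (reverse r) ++ map minC r         ≡⟨ cong₂ _++_ extra minima ⟩
  x ∷ concatMap extraEntries cs' ++ map minC (reverse cs')
    ≡⟨ cong (λ w → x ∷ concatMap extraEntries w ++ map minC (reverse cs')) (reverse-involutive cs') ⟨
  x ∷ rowWord (reverse cs')                                ∎
  where
    open ≡-Reasoning
    minima : map minC r ≡ map minC (reverse cs')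
    minima = begin
      map minC r                     ≡⟨ cong (map minC) (reverse-involutive r) ⟨
      map minC (reverse (reverse r)) ≡⟨ reverse-map minC (reverse r) ⟩
      reverse (map minC (reverse r)) ≡⟨ cong reverse mins ⟩
      reverse (map minC cs')         ≡⟨ reverse-map minC cs' ⟨
      map minC (reverse cs')         ∎

isSetValuedTableau-++⁻ʳ : ∀ B {A} → IsSetValuedTableau (B ++ A) → IsSetValuedTableau A
isSetValuedTableau-++⁻ʳ B (n , v , rr , co) =
  AllP.++⁻ʳ B n , AllP.++⁻ʳ B v , AllP.++⁻ʳ B rr , Linked-++⁻ʳ B co

maxC≡minC : ∀ {c} → ValidCell c → isMulti c ≡ false → maxC c ≡ minC c
maxC≡minC {_ ∷ []} _ _ = refl

toPlain-sorted : ∀ {r} → All (λ c → maxC c ≡ minC c) r → Linked RowRel r → Linked _≤_ (toPlain r)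
toPlain-sorted _                []        = []
toPlain-sorted _                [-]       = [-]
toPlain-sorted {c ∷ _} (e ∷ es) (c≤d ∷ l) = subst (_≤ _) e c≤d ∷ toPlain-sorted es l

toPlain-columnStrict : ∀ {r r'} → All (λ c → maxC c ≡ minC c) r → ColOK r r' →
  ColumnStrict (toPlain r) (toPlain r')
toPlain-columnStrict {r' = []}     _        _         = tt
toPlain-columnStrict {r' = _ ∷ _}  (e ∷ es) (c<c' , co) = subst (_< _) e c<c' , toPlain-columnStrict es co

toPlain-isSemistandard : ∀ {A} → IsSetValuedTableau A → All NoMulticell A → IsSemistandard (map toPlain A)
toPlain-isSemistandard {A} (n , v , rr , co) nm = semistandard
  (AllP.map⁺ (All.zipWith (λ (es , l) → Linked⇒AllPairs ≤-trans (toPlain-sorted es l)) (singletons , rr)))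
  (AllP.map⁺ (All.map (λ { {_ ∷ _} _ → nonEmpty }) n))
  (columns singletons co)
  where
    singletons : All (All (λ c → maxC c ≡ minC c)) A
    singletons = All.zipWith (All.zipWith (λ (vc , mc) → maxC≡minC vc mc)) (v , nm)
    columns : ∀ {A} → All (All (λ c → maxC c ≡ minC c)) A → Linked ColOK A →
      Linked ColumnStrict (map toPlain A)
    columns _        []       = []
    columns _        [-]      = [-]
    columns (es ∷ ess) (c ∷ l) = toPlain-columnStrict es c ∷ columns ess l

record DilationWords (S : Tableau) : Set where
  field
    above              : List (List ℕ)
    x                  : ℕ
    rest               : List ℕ
    above-semistandard : IsSemistandard above
    readingWord-S      : readingWord S ≡ plainReadingWord above ++ x ∷ rest
    readingWord-di     : readingWord (di S) ≡ plainReadingWord (insertT x above) ++ rest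

dilationWords : ∀ S → IsSetValuedTableau S → HasMulticell S → DilationWords S
dilationWords S st hm
  with splitTop-just (reverse S) (AnyP.reverse⁺ (Any.map rowHasMulti-Any hm))
... | above , r , below , split , rows , none , multi
  with removeFromFirstMulti-just (reverse r) (AnyP.reverse⁺ (rowHasMulti-true r multi))
... | x , cs' , removed , extra , mins = record
  { above              = map toPlain A
  ; x                  = x
  ; rest               = rest
  ; above-semistandard = toPlain-isSemistandard A-tableau (All-reverse none)
  ; readingWord-S      = begin
      readingWord S
        ≡⟨ cong readingWord S≡ ⟩
      readingWord (B ++ r ∷ A)
        ≡⟨ readingWord-++-∷ B r A ⟩
      readingWord A ++ rowWord r ++ readingWord B
        ≡⟨ cong₂ _++_ (readingWord-noMulticell A (All-reverse none))
                      (cong (_++ readingWord B) (rowWord-dilated r x cs' extra mins)) ⟩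
      plainReadingWord (map toPlain A) ++ x ∷ rest
        ∎
  ; readingWord-di     = begin
      readingWord (di S)
        ≡⟨ cong readingWord di≡ ⟩
      readingWord (B ++ reverse cs' ∷ map fromPlain T₁)
        ≡⟨ readingWord-++-∷ B (reverse cs') (map fromPlain T₁) ⟩
      readingWord (map fromPlain T₁) ++ rest
        ≡⟨ cong (_++ rest) (readingWord-fromPlain T₁) ⟩
      plainReadingWord T₁ ++ rest
        ∎
  }
  where
    open ≡-Reasoning
    A B : List Row
    A = reverse above
    B = reverse below
    T₁ : List (List ℕ)
    T₁ = insertT x (map toPlain A)
    rest : List ℕ
    rest = rowWord (reverse cs') ++ readingWord B
    S≡ : S ≡ B ++ r ∷ A
    S≡ = trans (sym (reverse-involutive S)) (trans (cong reverse rows) (reverse-++-∷ above r below))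
    di≡ : di S ≡ B ++ reverse cs' ∷ map fromPlain T₁
    di≡ rewrite split | removed = refl
    A-tableau : IsSetValuedTableau A
    A-tableau = isSetValuedTableau-++⁻ʳ [ r ] (isSetValuedTableau-++⁻ʳ B (subst IsSetValuedTableau S≡ st))

mainTheorem3 : (S : Tableau) → IsSetValuedTableau S → HasMulticell S →
    RSK (readingWord S) ≡ RSK (readingWord (di S))
mainTheorem3 S st hm = begin
  RSK (readingWord S)
    ≡⟨ cong RSK readingWord-S ⟩
  RSK (plainReadingWord above ++ x ∷ rest)
    ≡⟨ RSK-plainReadingWord-++ above (x ∷ rest) above-semistandard ⟩
  insertAll (insertT x above) rest
    ≡⟨ RSK-plainReadingWord-++ (insertT x above) rest (insertT-isSemistandard x above above-semistandard) ⟨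
  RSK (plainReadingWord (insertT x above) ++ rest)
    ≡⟨ cong RSK readingWord-di ⟨
  RSK (readingWord (di S))
    ∎
  where
    open ≡-Reasoning
    open DilationWords (dilationWords S st hm)
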